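{- In a $\{K_3,K_4\}$-decomposition of $K_{18}$ containing exactly $\alpha=11$ copies of $K_3$, every vertex $x$ satisfies $\alpha_x\in\{1,4\}$.
   Context: A $\{K_3,K_4\}$-decomposition of $K_v$ is a collection of subgraphs of $K_v$, each isomorphic to $K_3$ (triples) or $K_4$ (quadruples), whose edge sets partition $E(K_v)$. $\alpha$ is the number of copies of $K_3$ in the decomposition and, for a vertex $x$, $\alpha_x$ is the number of copies of $K_3$ containing $x$. -}

module Defs where

open import Data.Nat using (ℕ; zero; suc; _+_)
open import Data.Fin using (Fin)
open import Data.Fin.Properties using (_≟_)
open import Data.List using (List; []; _∷_; length; filter)
open import Data.List.Relation.Unary.All using (All)
open import Data.List.Relation.Unary.Unique.Propositional using (Unique)
open import Data.List.Membership.Propositional using (_∈_)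
import Data.List.Membership.DecPropositional as DM
open import Data.Product using (_×_; Σ; _,_)
open import Data.Sum using (_⊎_)
open import Relation.Binary.PropositionalEquality using (_≡_)
open import Relation.Nullary using (¬_)
open import Relation.Nullary.Decidable using (_×-dec_)

-- A block on vertex set Fin v: a list of pairwise distinct vertices.
-- It stands for the complete graph on those vertices.
Block : ℕ → Set
Block v = List (Fin v)

IsK3 : ∀ {v} → Block v → Set
IsK3 B = Unique B × length B ≡ 3

IsK4 : ∀ {v} → Block v → Set
IsK4 B = Unique B × length B ≡ 4

blocksWithEdge : ∀ {v} → Fin v → Fin v → List (Block v) → List (Block v)
blocksWithEdge {v} x y = filter (λ B → x ∈? B ×-dec y ∈? B)
  where open DM (_≟_ {v})

blocksAt : ∀ {v} → Fin v → List (Block v) → List (Block v)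
blocksAt {v} x = filter (λ B → x ∈? B)
  where open DM (_≟_ {v})

IsK34Decomposition : (v : ℕ) → List (Block v) → Set
IsK34Decomposition v D =
  All (λ B → IsK3 B ⊎ IsK4 B) D ×
  ((x y : Fin v) → ¬ (x ≡ y) → length (blocksWithEdge x y D) ≡ 1)

triples : ∀ {v} → List (Block v) → List (Block v)
triples = filter (λ B → length B Data.Nat.≟ 3)
  where import Data.Nat

α : ∀ {v} → List (Block v) → ℕ
α D = length (triples D)

αAt : ∀ {v} → List (Block v) → Fin v → ℕ
αAt D x = length (blocksAt x (triples D))

{-# OPTIONS --safe #-}

-- The blocks through a vertex z partition the other 17 vertices, so
-- 2 α_z + 3 β_z = 17, where β_z counts the K4s through z; hence α_z ∈ {1,4,7}.
-- Suppose α_x = 7 and let R be the 11 − 7 = 4 triples avoiding x.  A vertex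
-- y ≠ x lies on at most one triple through x (the one containing the edge xy),
-- so α_y ≤ 1 + deg_R y ≤ 5: thus α_y ∈ {1,4}, and α_y = 4 forces deg_R y ≥ 3.
-- Two such vertices would share 3 + 3 − 4 ≥ 2 triples of R, which is impossible
-- since two vertices share at most one block.  Hence Σ_{y ≠ x} α_y ≤ 17 + 3,
-- whereas double counting gives Σ_y α_y = 3α = 33, i.e. Σ_{y ≠ x} α_y = 26.

module Submission where

open import Defs
open import Data.Fin using (Fin; zero; suc; punchIn)
open import Data.Fin.Properties using (_≟_; suc-injective; punchIn-injective; punchInᵢ≢i)
open import Data.List using (List; []; _∷_; length; filter)
open import Data.List.Properties using (length-filter; filter-idem)
import Data.List.Membership.DecPropositional as DecMembership
open import Data.List.Relation.Binary.Sublist.Propositional using (_⊆_; ⊆-trans)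
open import Data.List.Relation.Binary.Sublist.Propositional.Properties
  using (filter-⊆; length-mono-≤) renaming (filter⁺ to filter⁺-⊆)
open import Data.List.Relation.Ternary.Interleaving.Properties using (interleave-length)
open import Data.List.Relation.Ternary.Interleaving.Propositional.Properties
  using () renaming (filter⁺ to filter-interleaving)
open import Data.List.Relation.Unary.All as All using (All; []; _∷_)
open import Data.List.Relation.Unary.All.Properties using (all-filter) renaming (filter⁺ to filter⁺-All)
open import Data.List.Relation.Unary.AllPairs using (_∷_)
open import Data.List.Relation.Unary.Unique.Propositional using (Unique)
open import Data.Nat using (ℕ; zero; suc; _+_; _*_; _%_; _≤_; _≤?_; z≤n; s≤s)
open import Data.Nat.DivMod using ([m+kn]%n≡m%n)
open import Data.Nat.Properties
  using (+-*-semiring; +-suc; *-suc; *-zeroʳ; *-comm; +-cancelˡ-≡; +-mono-≤; +-monoʳ-≤; *-monoʳ-≤;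
         ≤-refl; ≤-trans; ≤-reflexive; ≤-pred; ≰⇒>; module ≤-Reasoning)
  renaming (_≟_ to _≟ℕ_)
open import Algebra.Properties.Semiring.Sum +-*-semiring
  using (sum-syntax; sum-cong-≗; sum-replicate-zero; sum-remove; ∑-distrib-+; *-distribˡ-sum)
open import Data.Nat.Tactic.RingSolver using (solve-∀)
open import Data.Product using (_×_; _,_)
open import Data.Sum using (_⊎_; inj₁; inj₂; map₂)
open import Function using (_∘_; id)
open import Relation.Binary.PropositionalEquality
open import Relation.Nullary using (Dec; yes; no; ¬_; contradiction)
open import Relation.Nullary.Decidable using (from-no)
open import Relation.Unary using (Pred; Decidable)
open import Relation.Unary.Properties using (_∩?_; _∪?_; ∁?)

𝟙 : ∀ {p} {P : Set p} → Dec P → ℕ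
𝟙 (yes _) = 1
𝟙 (no _)  = 0

𝟙-yes : ∀ {p} {P : Set p} (P? : Dec P) → P → 𝟙 P? ≡ 1
𝟙-yes (yes _) _  = refl
𝟙-yes (no ¬p) p  = contradiction p ¬p

𝟙-no : ∀ {p} {P : Set p} (P? : Dec P) → ¬ P → 𝟙 P? ≡ 0
𝟙-no (yes p) ¬p = contradiction p ¬p
𝟙-no (no _)  _  = refl

∑-zero : ∀ {n} {f : Fin n → ℕ} → (∀ i → f i ≡ 0) → ∑[ i < n ] f i ≡ 0
∑-zero {n} f≡0 = trans (sum-cong-≗ f≡0) (sum-replicate-zero n)

∑-1 : ∀ n → ∑[ i < n ] 1 ≡ n
∑-1 zero    = refl
∑-1 (suc n) = cong suc (∑-1 n)

∑-mono-≤ : ∀ {n} {f g : Fin n → ℕ} → (∀ i → f i ≤ g i) → ∑[ i < n ] f i ≤ ∑[ i < n ] g i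
∑-mono-≤ {zero}  _   = z≤n
∑-mono-≤ {suc n} f≤g = +-mono-≤ (f≤g zero) (∑-mono-≤ (f≤g ∘ suc))

∑-𝟙-≡ : ∀ {n} (j : Fin n) → ∑[ i < n ] 𝟙 (i ≟ j) ≡ 1
∑-𝟙-≡ {suc n} j = begin
  ∑[ i < suc n ] 𝟙 (i ≟ j)                    ≡⟨ sum-remove {i = j} (λ i → 𝟙 (i ≟ j)) ⟩
  𝟙 (j ≟ j) + ∑[ k < n ] 𝟙 (punchIn j k ≟ j)  ≡⟨ cong₂ _+_ (𝟙-yes (j ≟ j) refl) others-zero ⟩
  1                                            ∎
  where
  open ≡-Reasoning
  others-zero : ∑[ k < n ] 𝟙 (punchIn j k ≟ j) ≡ 0
  others-zero = ∑-zero (λ k → 𝟙-no (punchIn j k ≟ j) (punchInᵢ≢i j k))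

∑-𝟙-≤1 : ∀ {n p} {P : Pred (Fin n) p} (P? : Decidable P) →
         (∀ i j → P i → P j → i ≡ j) → ∑[ i < n ] 𝟙 (P? i) ≤ 1
∑-𝟙-≤1 {zero}          _  _      = z≤n
∑-𝟙-≤1 {suc n} {P = P} P? unique = split (P? zero)
  where
  split : (P₀? : Dec (P zero)) → 𝟙 P₀? + ∑[ i < n ] 𝟙 (P? (suc i)) ≤ 1
  split (yes P₀) = ≤-reflexive (cong suc (∑-zero λ i →
    𝟙-no (P? (suc i)) (λ Pᵢ → contradiction (unique zero (suc i) P₀ Pᵢ) λ ())))
  split (no _)   = ∑-𝟙-≤1 (P? ∘ suc) (λ i j Pᵢ Pⱼ → suc-injective (unique (suc i) (suc j) Pᵢ Pⱼ))

length-filter-∷ : ∀ {a p} {A : Set a} {P : Pred A p} (P? : Decidable P) x xs →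
                  length (filter P? (x ∷ xs)) ≡ 𝟙 (P? x) + length (filter P? xs)
length-filter-∷ P? x xs with P? x
... | yes _ = refl
... | no  _ = refl

length-filter-∁ : ∀ {a p} {A : Set a} {P : Pred A p} (P? : Decidable P) xs →
                  length xs ≡ length (filter P? xs) + length (filter (∁? P?) xs)
length-filter-∁ P? xs = interleave-length (filter-interleaving P? xs)

module _ {a p q} {A : Set a} {P : Pred A p} {Q : Pred A q}
         (P? : Decidable P) (Q? : Decidable Q) where

  length-filter-∩ : ∀ xs → length (filter (P? ∩? Q?) xs) ≡ length (filter Q? (filter P? xs))
  length-filter-∩ []       = refl
  length-filter-∩ (x ∷ xs) with P? x
  ... | no  _ = length-filter-∩ xs
  ... | yes _ with Q? x
  ...   | yes _ = cong suc (length-filter-∩ xs)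
  ...   | no  _ = length-filter-∩ xs

  length-filter-split : ∀ xs → length (filter P? xs) ≡
    length (filter P? (filter Q? xs)) + length (filter P? (filter (∁? Q?) xs))
  length-filter-split []       = refl
  length-filter-split (x ∷ xs) with Q? x
  ... | yes _ with P? x
  ...   | yes _ = cong suc (length-filter-split xs)
  ...   | no  _ = length-filter-split xs
  length-filter-split (x ∷ xs) | no _ with P? x
  ...   | yes _ = trans (cong suc (length-filter-split xs)) (sym (+-suc _ _))
  ...   | no  _ = length-filter-split xs

  length-filter-∪-∩ : ∀ xs → length (filter P? xs) + length (filter Q? xs) ≡
    length (filter (P? ∪? Q?) xs) + length (filter (P? ∩? Q?) xs)
  length-filter-∪-∩ []       = refl
  length-filter-∪-∩ (x ∷ xs) with P? x | Q? x
  ... | yes _ | yes _ = cong suc (trans (+-suc _ _)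
                          (trans (cong suc (length-filter-∪-∩ xs)) (sym (+-suc _ _))))
  ... | yes _ | no  _ = cong suc (length-filter-∪-∩ xs)
  ... | no  _ | yes _ = trans (+-suc _ _) (cong suc (length-filter-∪-∩ xs))
  ... | no  _ | no  _ = length-filter-∪-∩ xs

module _ {n : ℕ} where
  open DecMembership (_≟_ {n}) using (_∈?_)

  𝟙-∈-∷ : ∀ {b : Fin n} {B} → All (b ≢_) B → ∀ y →
          𝟙 (y ∈? (b ∷ B)) ≡ 𝟙 (y ≟ b) + 𝟙 (y ∈? B)
  𝟙-∈-∷ {b} {B} b∉B y with y ≟ b | y ∈? B
  ... | yes refl | yes y∈B = contradiction refl (All.lookup b∉B y∈B)
  ... | yes _    | no  _   = refl
  ... | no  _    | yes _   = refl
  ... | no  _    | no  _   = refl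

  ∑-𝟙-∈ : ∀ {B : Block n} → Unique B → ∑[ y < n ] 𝟙 (y ∈? B) ≡ length B
  ∑-𝟙-∈ {[]}    _                = ∑-zero {n} (λ _ → refl)
  ∑-𝟙-∈ {b ∷ B} (b∉B ∷ B-unique) = begin
    ∑[ y < n ] 𝟙 (y ∈? (b ∷ B))
      ≡⟨ sum-cong-≗ (𝟙-∈-∷ b∉B) ⟩
    ∑[ y < n ] (𝟙 (y ≟ b) + 𝟙 (y ∈? B))
      ≡⟨ ∑-distrib-+ (λ y → 𝟙 (y ≟ b)) (λ y → 𝟙 (y ∈? B)) ⟩
    ∑[ y < n ] 𝟙 (y ≟ b) + ∑[ y < n ] 𝟙 (y ∈? B)
      ≡⟨ cong₂ _+_ (∑-𝟙-≡ b) (∑-𝟙-∈ B-unique) ⟩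
    suc (length B) ∎
    where open ≡-Reasoning

  ∑-length-blocksAt : ∀ {k} {L : List (Block n)} → All (λ B → Unique B × length B ≡ k) L →
                      ∑[ y < n ] length (blocksAt y L) ≡ k * length L
  ∑-length-blocksAt {k} {[]}    []                       =
    trans (∑-zero {n} (λ _ → refl)) (sym (*-zeroʳ k))
  ∑-length-blocksAt {k} {B ∷ L} ((B-unique , |B|≡k) ∷ Ls) = begin
    ∑[ y < n ] length (blocksAt y (B ∷ L))
      ≡⟨ sum-cong-≗ (λ y → length-filter-∷ (y ∈?_) B L) ⟩
    ∑[ y < n ] (𝟙 (y ∈? B) + length (blocksAt y L))
      ≡⟨ ∑-distrib-+ (λ y → 𝟙 (y ∈? B)) (λ y → length (blocksAt y L)) ⟩
    ∑[ y < n ] 𝟙 (y ∈? B) + ∑[ y < n ] length (blocksAt y L)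
      ≡⟨ cong₂ _+_ (trans (∑-𝟙-∈ B-unique) |B|≡k) (∑-length-blocksAt Ls) ⟩
    k + k * length L
      ≡⟨ sym (*-suc k (length L)) ⟩
    k * suc (length L) ∎
    where open ≡-Reasoning

  ∑-length-blocksWithEdge : ∀ {k} {L : List (Block n)} → All (λ B → Unique B × length B ≡ k) L →
                            ∀ z → ∑[ y < n ] length (blocksWithEdge z y L) ≡ k * length (blocksAt z L)
  ∑-length-blocksWithEdge {L = L} Ls z =
    trans (sum-cong-≗ (λ y → length-filter-∩ (z ∈?_) (y ∈?_) L))
          (∑-length-blocksAt (filter⁺-All (z ∈?_) Ls))

module _ {v : ℕ} where
  open DecMembership (_≟_ {v}) using (_∈?_)

  -- The decider used by `triples`, so that `triples D` is `filter isTriple? D` by definition.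
  isTriple? : Decidable (λ (B : Block v) → length B ≡ 3)
  isTriple? B = length B ≟ℕ 3

  quadruples : List (Block v) → List (Block v)
  quadruples = filter (∁? isTriple?)

  βAt : List (Block v) → Fin v → ℕ
  βAt D x = length (blocksAt x (quadruples D))

  triplesAvoiding : Fin v → List (Block v) → List (Block v)
  triplesAvoiding x D = filter (∁? (x ∈?_)) (triples D)

  triples-K3 : ∀ {D} → All (λ B → IsK3 B ⊎ IsK4 B) D → All IsK3 (triples D)
  triples-K3 {D} K34 = All.zipWith K3-of-length≡3 (filter⁺-All isTriple? K34 , all-filter isTriple? D)
    where
    K3-of-length≡3 : ∀ {B : Block v} → (IsK3 B ⊎ IsK4 B) × length B ≡ 3 → IsK3 B
    K3-of-length≡3 (inj₁ K3          , _)     = K3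
    K3-of-length≡3 (inj₂ (_ , |B|≡4) , |B|≡3) = contradiction (trans (sym |B|≡4) |B|≡3) λ ()

  quadruples-K4 : ∀ {D} → All (λ B → IsK3 B ⊎ IsK4 B) D → All IsK4 (quadruples D)
  quadruples-K4 {D} K34 =
    All.zipWith K4-of-length≢3 (filter⁺-All (∁? isTriple?) K34 , all-filter (∁? isTriple?) D)
    where
    K4-of-length≢3 : ∀ {B : Block v} → (IsK3 B ⊎ IsK4 B) × ¬ length B ≡ 3 → IsK4 B
    K4-of-length≢3 (inj₁ (_ , |B|≡3) , |B|≢3) = contradiction |B|≡3 |B|≢3
    K4-of-length≢3 (inj₂ K4          , _)     = K4

  blocksWithEdge-≤1 : ∀ {D L} → IsK34Decomposition v D → L ⊆ D →
                      ∀ {x y} → x ≢ y → length (blocksWithEdge x y L) ≤ 1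
  blocksWithEdge-≤1 {L = L} (_ , edge-once) L⊆D {x} {y} x≢y =
    subst (length (blocksWithEdge x y L) ≤_) (edge-once x y x≢y)
          (length-mono-≤ (filter⁺-⊆ xy? xy? (λ { refl → id }) L⊆D))
    where
    xy? = (x ∈?_) ∩? (y ∈?_)

  length-blocksAt-+-≤ : ∀ {D L} → IsK34Decomposition v D → L ⊆ D → ∀ {y z} → y ≢ z →
                        length (blocksAt y L) + length (blocksAt z L) ≤ length L + 1
  length-blocksAt-+-≤ {L = L} dec L⊆D {y} {z} y≢z = begin
    length (blocksAt y L) + length (blocksAt z L)
      ≡⟨ length-filter-∪-∩ (y ∈?_) (z ∈?_) L ⟩
    length (filter ((y ∈?_) ∪? (z ∈?_)) L) + length (blocksWithEdge y z L)
      ≤⟨ +-mono-≤ (length-filter ((y ∈?_) ∪? (z ∈?_)) L) (blocksWithEdge-≤1 dec L⊆D y≢z) ⟩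
    length L + 1 ∎
    where open ≤-Reasoning

  ∑-αAt : ∀ {D} → IsK34Decomposition v D → ∑[ y < v ] αAt D y ≡ 3 * α D
  ∑-αAt (K34 , _) = ∑-length-blocksAt (triples-K3 K34)

  α-split : ∀ D x → α D ≡ αAt D x + length (triplesAvoiding x D)
  α-split D x = length-filter-∁ (x ∈?_) (triples D)

  αAt-split : ∀ D x y → αAt D y ≡
    length (blocksWithEdge x y (triples D)) + length (blocksAt y (triplesAvoiding x D))
  αAt-split D x y = trans (length-filter-split (y ∈?_) (x ∈?_) (triples D))
                          (cong (_+ length (blocksAt y R)) (sym (length-filter-∩ (x ∈?_) (y ∈?_) (triples D))))
    where R = triplesAvoiding x D

degree-equation : ∀ {m} {D : List (Block (suc m))} → IsK34Decomposition (suc m) D →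
                  ∀ z → 2 * αAt D z + 3 * βAt D z ≡ m
degree-equation {m} {D} (K34 , edge-once) z =
  +-cancelˡ-≡ (a + b) _ _ (trans (rearrange a b) (trans (sym by-blocks) by-vertices))
  where
  open DecMembership (_≟_ {suc m}) using (_∈?_)
  open ≡-Reasoning
  a = αAt D z
  b = βAt D z

  rearrange : ∀ a b → (a + b) + (2 * a + 3 * b) ≡ 3 * a + 4 * b
  rearrange = solve-∀

  edges : Fin (suc m) → ℕ
  edges y = length (blocksWithEdge z y D)

  by-blocks : ∑[ y < suc m ] edges y ≡ 3 * a + 4 * b
  by-blocks = begin
    ∑[ y < suc m ] edges y
      ≡⟨ sum-cong-≗ (λ y → length-filter-split ((z ∈?_) ∩? (y ∈?_)) isTriple? D) ⟩
    ∑[ y < suc m ] (length (blocksWithEdge z y T) + length (blocksWithEdge z y Q))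
      ≡⟨ ∑-distrib-+ (λ y → length (blocksWithEdge z y T)) (λ y → length (blocksWithEdge z y Q)) ⟩
    ∑[ y < suc m ] length (blocksWithEdge z y T) + ∑[ y < suc m ] length (blocksWithEdge z y Q)
      ≡⟨ cong₂ _+_ (∑-length-blocksWithEdge (triples-K3 K34) z)
                   (∑-length-blocksWithEdge (quadruples-K4 K34) z) ⟩
    3 * a + 4 * b ∎
    where
    T = triples D
    Q = quadruples D

  by-vertices : ∑[ y < suc m ] edges y ≡ (a + b) + m
  by-vertices = begin
    ∑[ y < suc m ] edges y                   ≡⟨ sum-remove {i = z} edges ⟩
    edges z + ∑[ k < m ] edges (punchIn z k) ≡⟨ cong₂ _+_ through-z others ⟩
    (a + b) + m                              ∎
    where
    through-z : edges z ≡ a + b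
    through-z = begin
      length (filter ((z ∈?_) ∩? (z ∈?_)) D) ≡⟨ length-filter-∩ (z ∈?_) (z ∈?_) D ⟩
      length (filter (z ∈?_) (blocksAt z D)) ≡⟨ cong length (filter-idem (z ∈?_) D) ⟩
      length (blocksAt z D)                  ≡⟨ length-filter-split (z ∈?_) isTriple? D ⟩
      a + b                                  ∎
    others : ∑[ k < m ] edges (punchIn z k) ≡ m
    others = trans (sum-cong-≗ (λ k → edge-once z (punchIn z k) (punchInᵢ≢i z k ∘ sym))) (∑-1 m)

2a+3b≡17⇒a∈[1,4,7] : ∀ {a b} → 2 * a + 3 * b ≡ 17 → a ≡ 1 ⊎ a ≡ 4 ⊎ a ≡ 7
2a+3b≡17⇒a∈[1,4,7] {a} {b} eq =
  candidates a eq′ (trans (sym ([m+kn]%n≡m%n (a * 2) b 3)) (cong (_% 3) eq′))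
  where
  eq′ : a * 2 + b * 3 ≡ 17
  eq′ = trans (cong₂ _+_ (*-comm a 2) (*-comm b 3)) eq
  -- Stated with a * 2, which recurses on a, so that a ≥ 9 is refuted by unification.
  candidates : ∀ a → a * 2 + b * 3 ≡ 17 → a * 2 % 3 ≡ 2 → a ≡ 1 ⊎ a ≡ 4 ⊎ a ≡ 7
  candidates 0 _ ()
  candidates 1 _ _  = inj₁ refl
  candidates 2 _ ()
  candidates 3 _ ()
  candidates 4 _ _  = inj₂ (inj₁ refl)
  candidates 5 _ ()
  candidates 6 _ ()
  candidates 7 _ _  = inj₂ (inj₂ refl)
  candidates 8 _ ()
  candidates (suc (suc (suc (suc (suc (suc (suc (suc (suc _))))))))) () _

≤1+3·𝟙[3≤f] : ∀ {a t f} → a ≡ 1 ⊎ a ≡ 4 ⊎ a ≡ 7 → a ≡ t + f → t ≤ 1 → f ≤ 4 →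
              a ≤ 1 + 3 * 𝟙 (3 ≤? f)
≤1+3·𝟙[3≤f] (inj₁ refl) _ _ _ = s≤s z≤n
≤1+3·𝟙[3≤f] {f = f} (inj₂ (inj₁ refl)) 4≡t+f t≤1 _ with 3 ≤? f
... | yes _  = ≤-refl
... | no f≱3 =
  contradiction (subst (_≤ 3) (sym 4≡t+f) (+-mono-≤ t≤1 (≤-pred (≰⇒> f≱3)))) (from-no (4 ≤? 3))
≤1+3·𝟙[3≤f] (inj₂ (inj₂ refl)) 7≡t+f t≤1 f≤4 =
  contradiction (subst (_≤ 5) (sym 7≡t+f) (+-mono-≤ t≤1 f≤4)) (from-no (7 ≤? 5))

module _ {D : List (Block 18)} (dec : IsK34Decomposition 18 D) where
  open DecMembership (_≟_ {18}) using (_∈?_)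

  αAt∈[1,4,7] : ∀ x → αAt D x ≡ 1 ⊎ αAt D x ≡ 4 ⊎ αAt D x ≡ 7
  αAt∈[1,4,7] x = 2a+3b≡17⇒a∈[1,4,7] {b = βAt D x} (degree-equation dec x)

  module _ {x : Fin 18} (|R|≡4 : length (triplesAvoiding x D) ≡ 4) where
    private
      R = triplesAvoiding x D

      degR : Fin 18 → ℕ
      degR y = length (blocksAt y R)

      heavy? : Decidable (λ y → 3 ≤ degR y)
      heavy? y = 3 ≤? degR y

    heavy-unique : ∀ y z → 3 ≤ degR y → 3 ≤ degR z → y ≡ z
    heavy-unique y z 3≤degR-y 3≤degR-z with y ≟ z
    ... | yes y≡z = y≡z
    ... | no  y≢z = contradiction (begin
      6                   ≤⟨ +-mono-≤ 3≤degR-y 3≤degR-z ⟩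
      degR y + degR z     ≤⟨ length-blocksAt-+-≤ dec R⊆D y≢z ⟩
      length R + 1        ≡⟨ cong (_+ 1) |R|≡4 ⟩
      5                   ∎) (from-no (6 ≤? 5))
      where
      open ≤-Reasoning
      R⊆D : R ⊆ D
      R⊆D = ⊆-trans (filter-⊆ (∁? (x ∈?_)) (triples D)) (filter-⊆ isTriple? D)

    αAt-punchIn-≤ : ∀ j → αAt D (punchIn x j) ≤ 1 + 3 * 𝟙 (heavy? (punchIn x j))
    αAt-punchIn-≤ j = ≤1+3·𝟙[3≤f] (αAt∈[1,4,7] y) (αAt-split D x y)
      (blocksWithEdge-≤1 dec (filter-⊆ isTriple? D) (punchInᵢ≢i x j ∘ sym))
      (subst (degR y ≤_) |R|≡4 (length-filter (y ∈?_) R))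
      where y = punchIn x j

    ∑-αAt-punchIn-≤20 : ∑[ j < 17 ] αAt D (punchIn x j) ≤ 20
    ∑-αAt-punchIn-≤20 = begin
      ∑[ j < 17 ] αAt D (punchIn x j)
        ≤⟨ ∑-mono-≤ αAt-punchIn-≤ ⟩
      ∑[ j < 17 ] (1 + 3 * heavy j)
        ≡⟨ ∑-distrib-+ (λ _ → 1) (λ j → 3 * heavy j) ⟩
      17 + ∑[ j < 17 ] (3 * heavy j)
        ≡⟨ cong (17 +_) (sym (*-distribˡ-sum 3 heavy)) ⟩
      17 + 3 * ∑[ j < 17 ] heavy j
        ≤⟨ +-monoʳ-≤ 17 (*-monoʳ-≤ 3 at-most-one-heavy) ⟩
      20 ∎
      where
      open ≤-Reasoning
      heavy : Fin 17 → ℕ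
      heavy j = 𝟙 (heavy? (punchIn x j))
      at-most-one-heavy : ∑[ j < 17 ] heavy j ≤ 1
      at-most-one-heavy = ∑-𝟙-≤1 (heavy? ∘ punchIn x)
        (λ j k h₁ h₂ → punchIn-injective x j k (heavy-unique _ _ h₁ h₂))

  αAt≢7 : α D ≡ 11 → ∀ x → αAt D x ≢ 7
  αAt≢7 α≡11 x αx≡7 = from-no (26 ≤? 20) (subst (_≤ 20) ∑others≡26 (∑-αAt-punchIn-≤20 |R|≡4))
    where
    ∑others = ∑[ j < 17 ] αAt D (punchIn x j)

    ∑others≡26 : ∑others ≡ 26
    ∑others≡26 = +-cancelˡ-≡ 7 _ _ (begin
      7 + ∑others           ≡⟨ cong (_+ ∑others) (sym αx≡7) ⟩
      αAt D x + ∑others     ≡⟨ sym (sum-remove {i = x} (αAt D)) ⟩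
      ∑[ y < 18 ] αAt D y   ≡⟨ ∑-αAt dec ⟩
      3 * α D               ≡⟨ cong (3 *_) α≡11 ⟩
      33                    ∎)
      where open ≡-Reasoning

    R = triplesAvoiding x D

    |R|≡4 : length R ≡ 4
    |R|≡4 = +-cancelˡ-≡ 7 _ _ (begin
      7 + length R        ≡⟨ cong (_+ length R) (sym αx≡7) ⟩
      αAt D x + length R  ≡⟨ sym (α-split D x) ⟩
      α D                 ≡⟨ α≡11 ⟩
      11                  ∎)
      where open ≡-Reasoning

lemma13 : (D : List (Block 18)) → IsK34Decomposition 18 D → α D ≡ 11 →
    (x : Fin 18) → αAt D x ≡ 1 ⊎ αAt D x ≡ 4
lemma13 D dec α≡11 x = map₂ drop-7 (αAt∈[1,4,7] dec x)
  where
  drop-7 : αAt D x ≡ 4 ⊎ αAt D x ≡ 7 → αAt D x ≡ 4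
  drop-7 (inj₁ αx≡4) = αx≡4
  drop-7 (inj₂ αx≡7) = contradiction αx≡7 (αAt≢7 dec α≡11 x)
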